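{- If every Markov sequence of rationals is Cauchy, then Markov's principle holds.
   Context: Work constructively; $\tilde\exists x.A$ abbreviates $\neg\forall x.\neg A$. Markov's principle: for every decidable predicate $P$ on $\mathbb N$, $\neg\neg\exists n.\,P(n)$ implies $\exists n.\,P(n)$. A classical null sequence is a decreasing sequence $(q_n)$ in $\mathbb Q_{\ge0}\cup\{\infty\}$ with $\forall\epsilon>0.\,\tilde\exists m.\,\forall n\ge m.\,q_n\le\epsilon$. A modulus of non-divergence of a rational sequence $(q_n)$ is a classical null sequence $(c_n)$ with $\forall N.\,\forall n,m\ge N.\,|q_n-q_m|\le c_N$; a modulus of convergence is a non-decreasing $M:\mathbb N\to\mathbb N$ with $\forall k.\,\forall n,m\ge M(k).\,|q_n-q_m|\le2^{ -k}$. A rational sequence is Markov if it has a modulus of non-divergence and Cauchy if it has a modulus of convergence. -}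

module Defs where

open import Data.Nat as ℕ using (ℕ; zero; suc)
open import Data.Rational using (ℚ; 0ℚ; 1ℚ; ½; _*_; _-_; ∣_∣; _>_)
  renaming (_≤_ to _≤ℚ_)
open import Data.Product using (Σ; _×_)
open import Data.Unit using (⊤)
open import Data.Empty using (⊥)
open import Relation.Nullary using (¬_)
open import Relation.Unary using (Decidable)

-- ℚ≥0 ∪ {∞}, represented as ℚ ∪ {∞} plus a separate nonnegativity condition
data ℚ∞ : Set where
  fin : ℚ → ℚ∞
  ∞   : ℚ∞

data _≤∞_ : ℚ∞ → ℚ∞ → Set where
  fin≤fin : ∀ {p q} → p ≤ℚ q → fin p ≤∞ fin q
  _≤∞∞    : ∀ x → x ≤∞ ∞

NonNeg∞ : ℚ∞ → Set
NonNeg∞ (fin q) = 0ℚ ≤ℚ q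
NonNeg∞ ∞       = ⊤

∃~ : (ℕ → Set) → Set
∃~ A = ¬ (∀ n → ¬ A n)

IsClassicalNull : (ℕ → ℚ∞) → Set
IsClassicalNull c =
  (∀ n → NonNeg∞ (c n)) ×
  (∀ n → c (suc n) ≤∞ c n) ×
  (∀ (ε : ℚ) → ε > 0ℚ → ∃~ (λ m → ∀ n → m ℕ.≤ n → c n ≤∞ fin ε))

IsModulusOfNonDivergence : (ℕ → ℚ) → (ℕ → ℚ∞) → Set
IsModulusOfNonDivergence q c =
  IsClassicalNull c ×
  (∀ N n m → N ℕ.≤ n → N ℕ.≤ m → fin ∣ q n - q m ∣ ≤∞ c N)

half^ : ℕ → ℚ
half^ zero    = 1ℚ
half^ (suc k) = ½ * half^ k

IsModulusOfConvergence : (ℕ → ℚ) → (ℕ → ℕ) → Set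
IsModulusOfConvergence q M =
  (∀ k → M k ℕ.≤ M (suc k)) ×
  (∀ k n m → M k ℕ.≤ n → M k ℕ.≤ m → ∣ q n - q m ∣ ≤ℚ half^ k)

Markov : (ℕ → ℚ) → Set
Markov q = Σ (ℕ → ℚ∞) (IsModulusOfNonDivergence q)

Cauchy : (ℕ → ℚ) → Set
Cauchy q = Σ (ℕ → ℕ) (IsModulusOfConvergence q)

MarkovPrinciple : Set₁
MarkovPrinciple =
  (P : ℕ → Set) → Decidable P → ¬ ¬ Σ ℕ P → Σ ℕ P

module Submission where

-- Let P be a decidable predicate on ℕ with ¬¬∃n.P(n).
-- Consider the indicator sequence of "a witness has been seen":
--     q n = 1  if  P k  for some k < n,   q n = 0  otherwise,
-- together with the sequence  c n = 0  in the first case and  c n = ∞  in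
-- the second.  Since q is constant from the first witness on, c bounds the
-- oscillation of q, and ¬¬∃n.P(n) makes c a classical null sequence; so q is
-- Markov.  By hypothesis q is Cauchy; let M be a modulus of convergence.
-- Then the search for a witness below M 1 must succeed: if it failed, q (M 1)
-- would be 0 while q would eventually be 1, so |1 - 0| ≤ ½, absurd.

open import Defs
open import Data.Rational using (ℚ)
open import Data.Nat using (ℕ)

open import Data.Nat as ℕ using (suc; _+_; _<_; anyUpTo?)
open import Data.Nat.Properties as ℕ using (<-≤-trans; m≤n+m; m≤m+n)
open import Data.Rational using (0ℚ; 1ℚ; _-_; ∣_∣; _>_)
  renaming (_≤_ to _≤ℚ_; _≤?_ to _≤ℚ?_)
open import Data.Rational.Properties as ℚ using ()
open import Data.Product using (Σ; ∃; _×_; _,_)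
open import Data.Sum using (_⊎_; inj₁; inj₂)
open import Data.Empty using (⊥-elim)
open import Relation.Nullary using (¬_; Dec; yes; no)
open import Relation.Nullary.Decidable using (from-no)
open import Relation.Unary using (Decidable)
open import Relation.Binary.PropositionalEquality using (_≡_; refl; subst; subst₂; sym)

-- 1 and 0 are not ½-close; this is what rules out a jump of q past M 1.
one-far-from-zero : ¬ (∣ 1ℚ - 0ℚ ∣ ≤ℚ half^ 1)
one-far-from-zero = from-no (∣ 1ℚ - 0ℚ ∣ ≤ℚ? half^ 1)

module WitnessSequence (P : ℕ → Set) (P? : Decidable P) where

  Seen : ℕ → Set
  Seen n = ∃ λ k → k < n × P k

  seen? : ∀ n → Dec (Seen n)
  seen? = anyUpTo? P?

  seen-mono : ∀ {m n} → m ℕ.≤ n → Seen m → Seen n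
  seen-mono m≤n (k , k<m , p) = k , <-≤-trans k<m m≤n , p

  q : ℕ → ℚ
  q n with seen? n
  ... | yes _ = 1ℚ
  ... | no  _ = 0ℚ

  c : ℕ → ℚ∞
  c n with seen? n
  ... | yes _ = fin 0ℚ
  ... | no  _ = ∞

  q-seen : ∀ {n} → Seen n → q n ≡ 1ℚ
  q-seen {n} s with seen? n
  ... | yes _ = refl
  ... | no ¬s = ⊥-elim (¬s s)

  q-unseen : ∀ {n} → ¬ Seen n → q n ≡ 0ℚ
  q-unseen {n} ¬s with seen? n
  ... | yes s = ⊥-elim (¬s s)
  ... | no  _ = refl

  c-seen : ∀ {n} → Seen n → c n ≡ fin 0ℚ
  c-seen {n} s with seen? n
  ... | yes _ = refl
  ... | no ¬s = ⊥-elim (¬s s)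

  c-nonneg : ∀ n → NonNeg∞ (c n)
  c-nonneg n with seen? n
  ... | yes _ = ℚ.≤-refl
  ... | no  _ = _

  c-unseen-or-seen : ∀ n → c n ≡ ∞ ⊎ Seen n
  c-unseen-or-seen n with seen? n
  ... | yes s = inj₂ s
  ... | no  _ = inj₁ refl

  -- c only drops from ∞ to 0, hence is decreasing.
  c-decreasing : ∀ n → c (suc n) ≤∞ c n
  c-decreasing n with c-unseen-or-seen n
  ... | inj₁ cn≡∞ = subst (c (suc n) ≤∞_) (sym cn≡∞) (_ ≤∞∞)
  ... | inj₂ s    = subst₂ _≤∞_ (sym (c-seen (seen-mono (ℕ.n≤1+n n) s)))
                                  (sym (c-seen s)) (fin≤fin ℚ.≤-refl)

  -- Past N, q oscillates by at most c N: when c N is finite a witness is seen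
  -- at N, so q is constantly 1 from N on.
  c-bounds-q : ∀ N n m → N ℕ.≤ n → N ℕ.≤ m → fin ∣ q n - q m ∣ ≤∞ c N
  c-bounds-q N n m N≤n N≤m with seen? N
  ... | no  _ = _ ≤∞∞
  ... | yes s rewrite q-seen (seen-mono N≤n s) | q-seen (seen-mono N≤m s) =
    fin≤fin ℚ.≤-refl

  -- Under ¬¬∃P, c is eventually 0, classically: a witness k gives c n = 0
  -- for all n > k.
  c-null : ¬ ¬ Σ ℕ P →
           ∀ ε → ε > 0ℚ → ∃~ (λ m → ∀ n → m ℕ.≤ n → c n ≤∞ fin ε)
  c-null ¬¬∃P ε ε>0 never = ¬¬∃P λ (k , p) → never (suc k) λ n k<n →
    subst (_≤∞ fin ε) (sym (c-seen (k , k<n , p))) (fin≤fin (ℚ.<⇒≤ ε>0))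

  q-markov : ¬ ¬ Σ ℕ P → Markov q
  q-markov ¬¬∃P = c , (c-nonneg , c-decreasing , c-null ¬¬∃P) , c-bounds-q

  -- A modulus of convergence M of q fixes a search bound: if P has a
  -- witness k, then it is already seen at M 1, since otherwise
  -- q (suc k + M 1) = 1 and q (M 1) = 0 would be ½-close.
  unseen-at-modulus : ∀ {M} → IsModulusOfConvergence q M →
                      ¬ Seen (M 1) → ¬ Σ ℕ P
  unseen-at-modulus {M} (_ , close) ¬s (k , p) =
    one-far-from-zero (at-jump (close 1 n (M 1) (m≤n+m (M 1) (suc k)) ℕ.≤-refl))
    where
    n : ℕ
    n = suc k + M 1

    at-jump : ∣ q n - q (M 1) ∣ ≤ℚ half^ 1 → ∣ 1ℚ - 0ℚ ∣ ≤ℚ half^ 1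
    at-jump rewrite q-seen (k , m≤m+n (suc k) (M 1) , p) | q-unseen ¬s = λ le → le

  witness-from-modulus : ¬ ¬ Σ ℕ P → Cauchy q → Σ ℕ P
  witness-from-modulus ¬¬∃P (M , isModulus) with seen? (M 1)
  ... | yes (k , _ , p) = k , p
  ... | no ¬s = ⊥-elim (¬¬∃P (unseen-at-modulus isModulus ¬s))

lemma6p8 : ((q : ℕ → ℚ) → Markov q → Cauchy q) → MarkovPrinciple
lemma6p8 markov⇒cauchy P P? ¬¬∃P =
  witness-from-modulus ¬¬∃P (markov⇒cauchy q (q-markov ¬¬∃P))
  where open WitnessSequence P P?
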